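{- Let $p$ be an odd prime. Then $L(p-1)=\dfrac{(p-1)^2}{4}$.
   Context: For an odd prime $p$ and a positive integer $d$, define $$L(d)=\max_{1\le j\le p-1}\ \sum_{i=j}^{p-1}\left(\left\lfloor\frac{id}{p}\right\rfloor-\left\lfloor\frac{id}{p}-\left(1-\frac1p\right)\frac{jd}{p}\right\rfloor\right).$$ -}

module Defs where

open import Data.Nat as ℕ using (ℕ; suc; _∸_; NonZero)
open import Data.Integer as ℤ using (ℤ; +_; _⊔_)
open import Data.Rational as ℚ using (ℚ; _/_; 1ℚ; floor)
open import Data.List using (List; []; _∷_; foldr; map; upTo; sum)

-- maximum of a nonempty list of integers (the empty case never arises below for p ≥ 2)
maxℤ : List ℤ → ℤ
maxℤ []       = + 0
maxℤ (x ∷ xs) = foldr _⊔_ x xs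

range : ℕ → ℕ → List ℕ
range a b = map (λ k → a ℕ.+ k) (upTo (suc b ∸ a))

term : (p : ℕ) → .{{_ : NonZero p}} → (d j i : ℕ) → ℤ
term p d j i =
  floor ((+ (i ℕ.* d)) / p) ℤ.-
  floor ((+ (i ℕ.* d)) / p ℚ.- ((1ℚ ℚ.- ((+ 1) / p)) ℚ.* ((+ (j ℕ.* d)) / p)))

S : (p : ℕ) → .{{_ : NonZero p}} → (d j : ℕ) → ℤ
S p d j = foldr ℤ._+_ (+ 0) (map (term p d j) (range j (p ∸ 1)))

L : (p : ℕ) → .{{_ : NonZero p}} → (d : ℕ) → ℤ
L p d = maxℤ (map (S p d) (range 1 (p ∸ 1)))

-- With p = k + 1 and d = k = p - 1, the argument of the second floor is
-- (ikp - jk²)/p² = (i - j) - ((i - 2j)p + j)/p², while the first floor is i - 1.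
-- Hence the (j, i) summand is j - 1 for j ≤ i < 2j and j for 2j ≤ i, so the
-- inner sum is (j - 1)(p - j) + max(0, p - 2j).  For p = 2m + 1 this equals
-- m² - (m - j)² when j ≤ m and m² - (j - 1 - m)² when j > m, so the maximum
-- m² = (p - 1)²/4 is attained at j = m.
module Submission where

open import Defs
open import Data.Nat using (ℕ; _∸_; _^_; NonZero)
open import Data.Nat.Primality using (Prime)
open import Data.Integer using (+_)
open import Data.Rational using (_/_)
open import Relation.Binary.PropositionalEquality using (_≡_; _≢_)

open import Data.Nat.Base as ℕ using (zero; suc; pred; _+_; _*_; _≤_; _<_; z≤n; s≤s)
import Data.Nat.Properties as ℕ
import Data.Nat.DivMod as ℕ
open import Data.Nat.Coprimality using (Coprime)
open import Data.Nat.Divisibility using (divides; divides-refl)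
open import Data.Nat.GCD using (gcd; gcd[m,n]∣m; gcd[m,n]∣n; gcd[m,n]≢0; n/gcd[m,n]≢0)
open import Data.Nat.Primality using (composite-≢; prime⇒¬composite; prime⇒nonTrivial)
open import Data.Nat.Tactic.RingSolver as ℕ-Solver using ()
open import Data.Integer.Base as ℤ using (ℤ; 1ℤ; _⊔_)
import Data.Integer.Properties as ℤ
open import Data.Integer.DivMod using (div-pos-is-/ℕ)
open import Data.Integer.Tactic.RingSolver as ℤ-Solver using ()
open import Data.Rational.Base as ℚ using (1ℚ; floor; mkℚ+; toℚᵘ; fromℚᵘ)
import Data.Rational.Properties as ℚ
open import Data.Rational.Unnormalised.Base as ℚᵘ using (mkℚᵘ; 1ℚᵘ; *≡*; _≃_)
import Data.Rational.Unnormalised.Properties as ℚᵘ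
open import Data.List.Base using (_∷_; foldr; map; upTo; applyUpTo)
open import Data.List.Properties using (map-∘; map-upTo; foldr-preservesᵇ; foldr-preservesᵒ)
open import Data.List.Relation.Unary.All as All using (All; _∷_)
open import Data.List.Relation.Unary.Any as Any using (here; there)
open import Data.List.Membership.Propositional using (_∈_)
open import Data.List.Membership.Propositional.Properties using (∈-map⁺; ∈-map⁻; ∈-upTo⁺; ∈-upTo⁻)
open import Data.Product.Base using (∃-syntax; _×_; _,_; proj₁)
open import Data.Sum.Base using (_⊎_; inj₁; inj₂)
open import Function.Base using (_∘_)
open import Relation.Nullary.Decidable.Core using (yes; no)
open import Relation.Nullary.Negation using (contradiction)
open import Relation.Binary.PropositionalEquality using (refl; sym; trans; cong; cong₂; subst; module ≡-Reasoning)

≤-from-≡ : ∀ {m n} o → n ≡ m + o → m ≤ n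
≤-from-≡ o refl = ℕ.m≤m+n _ o

<-from-≡ : ∀ {m n} o → n ≡ suc (m + o) → m < n
<-from-≡ o refl = s≤s (ℕ.m≤m+n _ o)

m<n∸o⇒o+m<n : ∀ {m n} o → m < n ∸ o → o + m < n
m<n∸o⇒o+m<n {n = n}     zero    m<n   = m<n
m<n∸o⇒o+m<n {n = suc n} (suc o) m<n∸o = s≤s (m<n∸o⇒o+m<n o m<n∸o)

[m*n+r]/n≡m : ∀ m n {r} .{{_ : NonZero n}} → r < n → (m * n + r) ℕ./ n ≡ m
[m*n+r]/n≡m m n {r} r<n = begin
  (m * n + r) ℕ./ n          ≡⟨ ℕ.+-distrib-/-∣ˡ r (divides-refl m) ⟩
  m * n ℕ./ n + r ℕ./ n      ≡⟨ cong₂ _+_ (ℕ.m*n/n≡m m n) (ℕ.m<n⇒m/n≡0 r<n) ⟩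
  m + 0                      ≡⟨ ℕ.+-identityʳ m ⟩
  m                          ∎
  where open ≡-Reasoning

+m-+n≡+o : ∀ {m} n {o} → m ≡ n + o → + m ℤ.- + n ≡ + o
+m-+n≡+o {m} n {o} m≡n+o = begin
  + m ℤ.- + n        ≡⟨ ℤ.m-n≡m⊖n m n ⟩
  m ℤ.⊖ n            ≡⟨ ℤ.⊖-≥ (≤-from-≡ o m≡n+o) ⟩
  + (m ∸ n)          ≡⟨ cong (λ x → + (x ∸ n)) m≡n+o ⟩
  + (n + o ∸ n)      ≡⟨ cong +_ (ℕ.m+n∸m≡n n o) ⟩
  + o                ∎
  where open ≡-Reasoning

floor-mkℚ+ : ∀ m n .{{_ : NonZero n}} .(c : Coprime m n) → floor (mkℚ+ m n c) ≡ + (m ℕ./ n)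
floor-mkℚ+ m n@(suc _) c = div-pos-is-/ℕ (+ m) n

floor-/ : ∀ m n .{{_ : NonZero n}} → floor (+ m / n) ≡ + (m ℕ./ n)
floor-/ m n = trans (floor-mkℚ+ (m ℕ./ g) (n ℕ./ g) _) (cong +_ (begin
  (m ℕ./ g) ℕ./ (n ℕ./ g)              ≡⟨ ℕ.m*n/o*n≡m/o (m ℕ./ g) g (n ℕ./ g) ⟨
  (m ℕ./ g * g) ℕ./ (n ℕ./ g * g)      ≡⟨ ℕ./-congˡ (ℕ.m/n*n≡m (gcd[m,n]∣m m n)) ⟩
  m ℕ./ (n ℕ./ g * g)                  ≡⟨ ℕ./-congʳ (ℕ.m/n*n≡m (gcd[m,n]∣n m n)) ⟩
  m ℕ./ n                              ∎))
  where
  open ≡-Reasoning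
  g = gcd m n
  instance
    g≢0 : NonZero g
    g≢0 = ℕ.≢-nonZero (gcd[m,n]≢0 m n (inj₂ (ℕ.≢-nonZero⁻¹ n)))
    n/g≢0 : NonZero (n ℕ./ g)
    n/g≢0 = ℕ.≢-nonZero (n/gcd[m,n]≢0 m n)
    n/g*g≢0 : NonZero (n ℕ./ g * g)
    n/g*g≢0 = ℕ.m*n≢0 (n ℕ./ g) g

floor-/-quotient : ∀ {m} q n {r} .{{_ : NonZero n}} → m ≡ q * n + r → r < n → floor (+ m / n) ≡ + q
floor-/-quotient q n refl r<n = trans (floor-/ _ n) (cong +_ ([m*n+r]/n≡m q n r<n))

fromℚᵘ-homo-+ : ∀ p q → fromℚᵘ (p ℚᵘ.+ q) ≡ fromℚᵘ p ℚ.+ fromℚᵘ q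
fromℚᵘ-homo-+ p q = begin
  fromℚᵘ (p ℚᵘ.+ q)
    ≡⟨ ℚ.fromℚᵘ-cong (ℚᵘ.+-cong (ℚᵘ.≃-sym (ℚ.toℚᵘ-fromℚᵘ p))
                                (ℚᵘ.≃-sym (ℚ.toℚᵘ-fromℚᵘ q))) ⟩
  fromℚᵘ (toℚᵘ (fromℚᵘ p) ℚᵘ.+ toℚᵘ (fromℚᵘ q))
    ≡⟨ ℚ.fromℚᵘ-cong (ℚᵘ.≃-sym (ℚ.toℚᵘ-homo-+ (fromℚᵘ p) (fromℚᵘ q))) ⟩
  fromℚᵘ (toℚᵘ (fromℚᵘ p ℚ.+ fromℚᵘ q))
    ≡⟨ ℚ.fromℚᵘ-toℚᵘ _ ⟩
  fromℚᵘ p ℚ.+ fromℚᵘ q ∎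
  where open ≡-Reasoning

fromℚᵘ-homo-* : ∀ p q → fromℚᵘ (p ℚᵘ.* q) ≡ fromℚᵘ p ℚ.* fromℚᵘ q
fromℚᵘ-homo-* p q = begin
  fromℚᵘ (p ℚᵘ.* q)
    ≡⟨ ℚ.fromℚᵘ-cong (ℚᵘ.*-cong (ℚᵘ.≃-sym (ℚ.toℚᵘ-fromℚᵘ p))
                                (ℚᵘ.≃-sym (ℚ.toℚᵘ-fromℚᵘ q))) ⟩
  fromℚᵘ (toℚᵘ (fromℚᵘ p) ℚᵘ.* toℚᵘ (fromℚᵘ q))
    ≡⟨ ℚ.fromℚᵘ-cong (ℚᵘ.≃-sym (ℚ.toℚᵘ-homo-* (fromℚᵘ p) (fromℚᵘ q))) ⟩
  fromℚᵘ (toℚᵘ (fromℚᵘ p ℚ.* fromℚᵘ q))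
    ≡⟨ ℚ.fromℚᵘ-toℚᵘ _ ⟩
  fromℚᵘ p ℚ.* fromℚᵘ q ∎
  where open ≡-Reasoning

fromℚᵘ-homo‿- : ∀ p → fromℚᵘ (ℚᵘ.- p) ≡ ℚ.- fromℚᵘ p
fromℚᵘ-homo‿- p = begin
  fromℚᵘ (ℚᵘ.- p)
    ≡⟨ ℚ.fromℚᵘ-cong (ℚᵘ.-‿cong (ℚᵘ.≃-sym (ℚ.toℚᵘ-fromℚᵘ p))) ⟩
  fromℚᵘ (ℚᵘ.- toℚᵘ (fromℚᵘ p))
    ≡⟨ ℚ.fromℚᵘ-cong (ℚᵘ.≃-sym (ℚ.toℚᵘ-homo‿- (fromℚᵘ p))) ⟩
  fromℚᵘ (toℚᵘ (ℚ.- fromℚᵘ p))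
    ≡⟨ ℚ.fromℚᵘ-toℚᵘ _ ⟩
  ℚ.- fromℚᵘ p ∎
  where open ≡-Reasoning

fromℚᵘ-homo-- : ∀ p q → fromℚᵘ (p ℚᵘ.- q) ≡ fromℚᵘ p ℚ.- fromℚᵘ q
fromℚᵘ-homo-- p q = trans (fromℚᵘ-homo-+ p (ℚᵘ.- q)) (cong (fromℚᵘ p ℚ.+_) (fromℚᵘ-homo‿- q))

-- All unnormalised denominators here are + suc _, so their ℕ-products agree
-- definitionally with ℤ-products and the goal is an instance of a ring identity.
ℚᵘ-sub-scaled : ∀ (a b : ℤ) k →
  mkℚᵘ a k ℚᵘ.- (1ℚᵘ ℚᵘ.- mkℚᵘ (+ 1) k) ℚᵘ.* mkℚᵘ b k
    ≃ mkℚᵘ (a ℤ.* + suc k ℤ.- + k ℤ.* b) (k + k * suc k)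
ℚᵘ-sub-scaled a b k = *≡* (identity a b (+ k))
  where
  identity : ∀ a b K → let P = 1ℤ ℤ.+ K in
    (a ℤ.* ((1ℤ ℤ.* P) ℤ.* P) ℤ.+ ℤ.- ((1ℤ ℤ.* P ℤ.+ ℤ.- 1ℤ ℤ.* 1ℤ) ℤ.* b) ℤ.* P)
      ℤ.* (P ℤ.* P)
      ≡ (a ℤ.* P ℤ.- K ℤ.* b) ℤ.* (P ℤ.* ((1ℤ ℤ.* P) ℤ.* P))
  identity = ℤ-Solver.solve-∀

sub-scaled : ∀ (a b : ℤ) k →
  a / suc k ℚ.- (1ℚ ℚ.- + 1 / suc k) ℚ.* (b / suc k) ≡ (a ℤ.* + suc k ℤ.- + k ℤ.* b) / (suc k * suc k)
sub-scaled a b k = sym (begin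
  fromℚᵘ (mkℚᵘ (a ℤ.* + suc k ℤ.- + k ℤ.* b) (k + k * suc k))
    ≡⟨ ℚ.fromℚᵘ-cong (ℚᵘ.≃-sym (ℚᵘ-sub-scaled a b k)) ⟩
  fromℚᵘ (A ℚᵘ.- (1ℚᵘ ℚᵘ.- U) ℚᵘ.* B)
    ≡⟨ fromℚᵘ-homo-- A ((1ℚᵘ ℚᵘ.- U) ℚᵘ.* B) ⟩
  fromℚᵘ A ℚ.- fromℚᵘ ((1ℚᵘ ℚᵘ.- U) ℚᵘ.* B)
    ≡⟨ cong (λ x → fromℚᵘ A ℚ.- x) (fromℚᵘ-homo-* (1ℚᵘ ℚᵘ.- U) B) ⟩
  fromℚᵘ A ℚ.- fromℚᵘ (1ℚᵘ ℚᵘ.- U) ℚ.* fromℚᵘ B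
    ≡⟨ cong (λ x → fromℚᵘ A ℚ.- x ℚ.* fromℚᵘ B) (fromℚᵘ-homo-- 1ℚᵘ U) ⟩
  fromℚᵘ A ℚ.- (fromℚᵘ 1ℚᵘ ℚ.- fromℚᵘ U) ℚ.* fromℚᵘ B ∎)
  where
  open ≡-Reasoning
  A = mkℚᵘ a k
  B = mkℚᵘ b k
  U = mkℚᵘ (+ 1) k

term-quotients : ∀ {k j i} q {r} q′ {r′} →
  i * k ≡ q * suc k + r → r < suc k →
  i * k * suc k ≡ k * (j * k) + (q′ * (suc k * suc k) + r′) → r′ < suc k * suc k →
  term (suc k) k j i ≡ + q ℤ.- + q′
term-quotients {k} {j} {i} q {r} q′ {r′} e r<p e′ r′<p² =
  cong₂ ℤ._-_ (floor-/-quotient q (suc k) e r<p) (begin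
  floor (+ (i * k) / suc k ℚ.- (1ℚ ℚ.- + 1 / suc k) ℚ.* (+ (j * k) / suc k))
    ≡⟨ cong floor (sub-scaled (+ (i * k)) (+ (j * k)) k) ⟩
  floor ((+ (i * k) ℤ.* + suc k ℤ.- + k ℤ.* + (j * k)) / (suc k * suc k))
    ≡⟨ cong (λ z → floor (z / (suc k * suc k))) numerator ⟩
  floor (+ (q′ * (suc k * suc k) + r′) / (suc k * suc k))
    ≡⟨ floor-/-quotient q′ (suc k * suc k) refl r′<p² ⟩
  + q′ ∎)
  where
  open ≡-Reasoning
  numerator : + (i * k) ℤ.* + suc k ℤ.- + k ℤ.* + (j * k) ≡ + (q′ * (suc k * suc k) + r′)
  numerator = trans (cong₂ ℤ._-_ (sym (ℤ.pos-* (i * k) (suc k))) (sym (ℤ.pos-* k (j * k))))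
                    (+m-+n≡+o (k * (j * k)) e′)

-- With j = 1 + t + u, i = j + t and k = i + v: ⌊ik/p⌋ = i - 1 with remainder p - i,
-- and the second floor is t = i - j with remainder (j - t)p - j.
term-below : ∀ {k j i} → j ≤ i → i < j + j → i ≤ k → term (suc k) k j i ≡ + pred j
term-below {j = j} j≤i i<2j i≤k with ℕ.m≤n⇒∃[o]m+o≡n j≤i
... | t , refl with ℕ.m≤n⇒∃[o]m+o≡n (ℕ.+-cancelˡ-< j t j i<2j) | ℕ.m≤n⇒∃[o]m+o≡n i≤k
... | u , refl | v , refl = trans
  (term-quotients {suc t + u + t + v} {suc t + u} {suc t + u + t} (t + u + t) t
    (first-division t u v) (<-from-≡ _ (first-remainder<p t u v))
    (second-division t u v) (<-from-≡ _ (second-remainder<p² t u v)))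
  (+m-+n≡+o t (difference t u))
  where
  first-division : ∀ t u v → let i = suc t + u + t in i * (i + v) ≡ (t + u + t) * suc (i + v) + suc v
  first-division = ℕ-Solver.solve-∀
  first-remainder<p : ∀ t u v → let i = suc t + u + t in suc (i + v) ≡ suc (suc v + (t + u + t))
  first-remainder<p = ℕ-Solver.solve-∀
  second-division : ∀ t u v → let j = suc t + u ; i = j + t ; k = i + v in
    i * k * suc k ≡ k * (j * k) + (t * (suc k * suc k) + (u * k + (j + v)))
  second-division = ℕ-Solver.solve-∀
  second-remainder<p² : ∀ t u v → let j = suc t + u ; k = j + t + v in
    suc k * suc k ≡ suc (u * k + (j + v) + (k * (t + t + 1 + v) + k + t))
  second-remainder<p² = ℕ-Solver.solve-∀
  difference : ∀ t u → t + u + t ≡ t + (t + u)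
  difference = ℕ-Solver.solve-∀

-- With j = 1 + j′, i = 2j + s and k = i + w: ⌊ik/p⌋ = i - 1 with remainder p - i,
-- and the second floor is i - j - 1 with remainder p² - sp - j.
term-above : ∀ {k j i} → 1 ≤ j → j + j ≤ i → i ≤ k → term (suc k) k j i ≡ + j
term-above {j = suc j′} (s≤s z≤n) 2j≤i i≤k with ℕ.m≤n⇒∃[o]m+o≡n 2j≤i
... | s , refl with ℕ.m≤n⇒∃[o]m+o≡n i≤k
... | w , refl = trans
  (term-quotients {suc j′ + suc j′ + s + w} {suc j′} {suc j′ + suc j′ + s} (j′ + suc j′ + s) (j′ + s)
    (first-division j′ s w) (<-from-≡ _ (first-remainder<p j′ s w))
    (second-division j′ s w) (<-from-≡ _ (second-remainder<p² j′ s w)))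
  (+m-+n≡+o (j′ + s) (difference j′ s))
  where
  first-division : ∀ j′ s w → let i = suc j′ + suc j′ + s in
    i * (i + w) ≡ (j′ + suc j′ + s) * suc (i + w) + suc w
  first-division = ℕ-Solver.solve-∀
  first-remainder<p : ∀ j′ s w → let i = suc j′ + suc j′ + s in
    suc (i + w) ≡ suc (suc w + (j′ + suc j′ + s))
  first-remainder<p = ℕ-Solver.solve-∀
  second-division : ∀ j′ s w → let j = suc j′ ; i = j + j + s ; k = i + w in
    i * k * suc k ≡ k * (j * k) + ((j′ + s) * (suc k * suc k) + (suc k * (j + w + 1) + k * j))
  second-division = ℕ-Solver.solve-∀
  second-remainder<p² : ∀ j′ s w → let j = suc j′ ; k = j + j + s + w in
    suc k * suc k ≡ suc (suc k * (j + w + 1) + k * j + (j′ + suc k * s))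
  second-remainder<p² = ℕ-Solver.solve-∀
  difference : ∀ j′ s → j′ + suc j′ + s ≡ j′ + s + suc j′
  difference = ℕ-Solver.solve-∀

∑ : ℕ → (ℕ → ℤ) → ℤ
∑ n f = foldr ℤ._+_ (+ 0) (applyUpTo f n)

∑-+ : ∀ m n f → ∑ (m + n) f ≡ ∑ m f ℤ.+ ∑ n (λ i → f (m + i))
∑-+ zero    n f = sym (ℤ.+-identityˡ (∑ n f))
∑-+ (suc m) n f = trans (cong (λ x → f 0 ℤ.+ x) (∑-+ m n (f ∘ suc))) (sym (ℤ.+-assoc (f 0) _ _))

∑-const : ∀ n f {c} → (∀ i → i < n → f i ≡ + c) → ∑ n f ≡ + (n * c)
∑-const zero    f fi≡c = refl
∑-const (suc n) f fi≡c =
  cong₂ ℤ._+_ (fi≡c 0 (s≤s z≤n)) (∑-const n (f ∘ suc) (λ i i<n → fi≡c (suc i) (s≤s i<n)))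

S≡∑ : ∀ k j → S (suc k) k j ≡ ∑ (suc k ∸ j) (λ i → term (suc k) k j (j + i))
S≡∑ k j = cong (foldr ℤ._+_ (+ 0)) (trans (sym (map-∘ (upTo (suc k ∸ j)))) (map-upTo _ (suc k ∸ j)))

S-low : ∀ {k j} → 1 ≤ j → j + j ≤ suc k → S (suc k) k j ≡ + (j * pred j + (suc k ∸ (j + j)) * j)
S-low {k} {j} 1≤j 2j≤p = begin
  S (suc k) k j                                              ≡⟨ S≡∑ k j ⟩
  ∑ (suc k ∸ j) f                                            ≡⟨ cong (λ n → ∑ n f) split ⟩
  ∑ (j + (suc k ∸ (j + j))) f                                ≡⟨ ∑-+ j (suc k ∸ (j + j)) f ⟩
  ∑ j f ℤ.+ ∑ (suc k ∸ (j + j)) (λ i → f (j + i))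
    ≡⟨ cong₂ ℤ._+_ (∑-const j f below) (∑-const _ _ above) ⟩
  + (j * pred j + (suc k ∸ (j + j)) * j)                     ∎
  where
  open ≡-Reasoning
  f : ℕ → ℤ
  f i = term (suc k) k j (j + i)
  split : suc k ∸ j ≡ j + (suc k ∸ (j + j))
  split = trans (sym (ℕ.m+[n∸m]≡n (ℕ.m+n≤o⇒m≤o∸n j 2j≤p))) (cong (_+_ j) (ℕ.∸-+-assoc (suc k) j j))
  below : ∀ i → i < j → f i ≡ + pred j
  below i i<j = term-below (ℕ.m≤m+n j i) (ℕ.+-monoʳ-< j i<j)
    (ℕ.≤-pred (ℕ.<-≤-trans (ℕ.+-monoʳ-< j i<j) 2j≤p))
  above : ∀ i → i < suc k ∸ (j + j) → f (j + i) ≡ + j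
  above i i< = term-above 1≤j (≤-from-≡ i (sym (ℕ.+-assoc j j i)))
    (ℕ.≤-pred (subst (_< suc k) (ℕ.+-assoc j j i) (m<n∸o⇒o+m<n (j + j) i<)))

S-high : ∀ {k j} → suc k < j + j → S (suc k) k j ≡ + ((suc k ∸ j) * pred j)
S-high {k} {j} p<2j = trans (S≡∑ k j) (∑-const (suc k ∸ j) _ below)
  where
  below : ∀ i → i < suc k ∸ j → term (suc k) k j (j + i) ≡ + pred j
  below i i< = term-below (ℕ.m≤m+n j i) (ℕ.<-trans (m<n∸o⇒o+m<n j i<) p<2j) (ℕ.≤-pred (m<n∸o⇒o+m<n j i<))

[m∸n]*[m+n]≤m*m : ∀ m n → (m ∸ n) * (m + n) ≤ m * m
[m∸n]*[m+n]≤m*m m n with n ℕ.≤? m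
... | no n≰m =
  subst (λ x → x * (m + n) ≤ m * m) (sym (ℕ.m≤n⇒m∸n≡0 (ℕ.<⇒≤ (ℕ.≰⇒> n≰m)))) z≤n
... | yes n≤m with ℕ.m≤n⇒∃[o]m+o≡n n≤m
...   | f , refl = ≤-from-≡ (n * n)
  (trans (square n f) (cong (λ x → x * (n + f + n) + n * n) (sym (ℕ.m+n∸m≡n n f))))
  where
  square : ∀ n f → (n + f) * (n + f) ≡ f * (n + f + n) + n * n
  square = ℕ-Solver.solve-∀

S-odd-≤-high : ∀ {m j} → m < j → S (suc (m + m)) (m + m) j ℤ.≤ + (m * m)
S-odd-≤-high {m} m<j with ℕ.m≤n⇒∃[o]m+o≡n m<j
... | e , refl = subst (ℤ._≤ + (m * m)) (sym (S-high {m + m} {suc m + e} p<2j))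
  (ℤ.+≤+ (subst (λ x → x * (m + e) ≤ m * m) (sym (ℕ.[m+n]∸[m+o]≡n∸o (suc m) m e))
    ([m∸n]*[m+n]≤m*m m e)))
  where
  p<2j : suc (m + m) < (suc m + e) + (suc m + e)
  p<2j = subst (_≤ (suc m + e) + (suc m + e)) (cong suc (ℕ.+-suc m m)) (ℕ.+-mono-≤ m<j m<j)

S-odd-≤-low : ∀ {m j} → 1 ≤ j → j ≤ m → S (suc (m + m)) (m + m) j ℤ.≤ + (m * m)
S-odd-≤-low {j = suc j′} (s≤s z≤n) j≤m with ℕ.m≤n⇒∃[o]m+o≡n j≤m
... | e , refl =
  subst (ℤ._≤ + (m * m)) (sym (S-low {m + m} {j} (s≤s z≤n) (ℕ.m≤n⇒m≤1+n (ℕ.+-mono-≤ j≤m j≤m))))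
  (ℤ.+≤+ (≤-from-≡ (e * e) (trans (square j′ e) (cong (λ x → j * j′ + x * j + e * e) (sym p∸2j)))))
  where
  j = suc j′
  m = j + e
  p∸2j : suc (m + m) ∸ (j + j) ≡ suc (e + e)
  p∸2j = trans (cong (_∸ (j + j)) (p≡2j+1+2e j′ e)) (ℕ.m+n∸m≡n (j + j) (suc (e + e)))
    where
    p≡2j+1+2e : ∀ j′ e → let j = suc j′ ; m = j + e in suc (m + m) ≡ j + j + suc (e + e)
    p≡2j+1+2e = ℕ-Solver.solve-∀
  square : ∀ j′ e → (suc j′ + e) * (suc j′ + e) ≡ suc j′ * j′ + suc (e + e) * suc j′ + e * e
  square = ℕ-Solver.solve-∀

S-odd-≤ : ∀ {m j} → 1 ≤ j → S (suc (m + m)) (m + m) j ℤ.≤ + (m * m)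
S-odd-≤ {m} {j} 1≤j with j ℕ.≤? m
... | yes j≤m = S-odd-≤-low 1≤j j≤m
... | no j≰m  = S-odd-≤-high (ℕ.≰⇒> j≰m)

S-odd-half : ∀ {m} → 1 ≤ m → S (suc (m + m)) (m + m) m ≡ + (m * m)
S-odd-half {suc m′} 1≤m = begin
  S (suc (m + m)) (m + m) m
    ≡⟨ S-low {m + m} {m} 1≤m (ℕ.n≤1+n (m + m)) ⟩
  + (m * m′ + (suc (m + m) ∸ (m + m)) * m)
    ≡⟨ cong (λ x → + (m * m′ + x * m)) (ℕ.m+n∸n≡m 1 (m + m)) ⟩
  + (m * m′ + 1 * m)
    ≡⟨ cong +_ (half m′) ⟩
  + (m * m) ∎
  where
  open ≡-Reasoning
  m = suc m′
  half : ∀ m′ → suc m′ * m′ + 1 * suc m′ ≡ suc m′ * suc m′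
  half = ℕ-Solver.solve-∀

maxℤ-≡ : ∀ {M xs} → M ∈ xs → All (ℤ._≤ M) xs → maxℤ xs ≡ M
maxℤ-≡ {M} {x ∷ xs} M∈x∷xs (x≤M ∷ xs≤M) = ℤ.≤-antisym
  (foldr-preservesᵇ {P = ℤ._≤ M} ℤ.⊔-lub x≤M xs≤M)
  (foldr-preservesᵒ {P = M ℤ.≤_} ≤-⊔ x xs (≤-member M∈x∷xs))
  where
  ≤-⊔ : ∀ y z → M ℤ.≤ y ⊎ M ℤ.≤ z → M ℤ.≤ y ⊔ z
  ≤-⊔ y z (inj₁ M≤y) = ℤ.i≤j⇒i≤j⊔k z M≤y
  ≤-⊔ y z (inj₂ M≤z) = ℤ.i≤j⇒i≤k⊔j y M≤z
  ≤-member : M ∈ x ∷ xs → M ℤ.≤ x ⊎ Any.Any (M ℤ.≤_) xs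
  ≤-member (here M≡x)  = inj₁ (ℤ.≤-reflexive M≡x)
  ≤-member (there M∈xs) = inj₂ (Any.map ℤ.≤-reflexive M∈xs)

∈-range⁺ : ∀ {a b x} → a ≤ x → x ≤ b → x ∈ range a b
∈-range⁺ {a} {b} {x} a≤x x≤b = subst (_∈ range a b) (ℕ.m+[n∸m]≡n a≤x)
  (∈-map⁺ (_+_ a) (∈-upTo⁺ (ℕ.∸-monoˡ-< (s≤s x≤b) a≤x)))

∈-range⁻ : ∀ {a b x} → x ∈ range a b → a ≤ x × x ≤ b
∈-range⁻ {a} x∈ with ∈-map⁻ (_+_ a) x∈
... | t , t∈ , refl = ℕ.m≤m+n a t , ℕ.≤-pred (m<n∸o⇒o+m<n a (∈-upTo⁻ t∈))

L-odd : ∀ {m} → 1 ≤ m → L (suc (m + m)) (m + m) ≡ + (m * m)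
L-odd {m} 1≤m = maxℤ-≡
  (subst (_∈ map S′ (range 1 (m + m))) (S-odd-half 1≤m) (∈-map⁺ S′ (∈-range⁺ 1≤m (ℕ.m≤m+n m m))))
  (All.tabulate ≤-m²)
  where
  S′ : ℕ → ℤ
  S′ = S (suc (m + m)) (m + m)
  ≤-m² : ∀ {x} → x ∈ map S′ (range 1 (m + m)) → x ℤ.≤ + (m * m)
  ≤-m² x∈ with ∈-map⁻ S′ x∈
  ... | j , j∈ , refl = S-odd-≤ {m} (proj₁ (∈-range⁻ j∈))

even⊎odd : ∀ n → ∃[ m ] (n ≡ m + m ⊎ n ≡ suc (m + m))
even⊎odd zero = 0 , inj₁ refl
even⊎odd (suc n) with even⊎odd n
... | m , inj₁ n≡2m   = m , inj₂ (cong suc n≡2m)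
... | m , inj₂ n≡2m+1 = suc m , inj₁ (trans (cong suc n≡2m+1) (cong suc (sym (ℕ.+-suc m m))))

odd-prime : ∀ {p} .{{_ : NonZero p}} → Prime p → p ≢ 2 → ∃[ m ] 1 ≤ m × p ≡ suc (m + m)
odd-prime {p} pr p≢2 with even⊎odd p
... | m , inj₁ refl =
  contradiction (composite-≢ 2 (p≢2 ∘ sym) (divides m (m+m≡m*2 m))) (prime⇒¬composite pr)
  where
  m+m≡m*2 : ∀ m → m + m ≡ m * 2
  m+m≡m*2 = ℕ-Solver.solve-∀
... | zero , inj₂ refl = contradiction (ℕ.nonTrivial⇒n>1 1 {{prime⇒nonTrivial pr}}) (ℕ.<-irrefl refl)
... | suc m , inj₂ refl = suc m , s≤s z≤n , refl

m*m/1≡[m+m]^2/4 : ∀ m → + (m * m) / 1 ≡ + ((m + m) ^ 2) / 4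
m*m/1≡[m+m]^2/4 m = ℚ.fromℚᵘ-cong {mkℚᵘ (+ (m * m)) 0} {mkℚᵘ (+ ((m + m) ^ 2)) 3} (*≡* (begin
  + (m * m) ℤ.* + 4          ≡⟨ ℤ.pos-* (m * m) 4 ⟨
  + (m * m * 4)              ≡⟨ cong +_ (quadruple m) ⟩
  + ((m + m) ^ 2 * 1)        ≡⟨ ℤ.pos-* ((m + m) ^ 2) 1 ⟩
  + ((m + m) ^ 2) ℤ.* + 1    ∎))
  where
  open ≡-Reasoning
  quadruple : ∀ m → m * m * 4 ≡ (m + m) * ((m + m) * 1) * 1
  quadruple = ℕ-Solver.solve-∀

lemma2p4 : (p : ℕ) → .{{_ : NonZero p}} → Prime p → p ≢ 2 →
    (L p (p ∸ 1)) / 1 ≡ (+ ((p ∸ 1) ^ 2)) / 4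
lemma2p4 p pr p≢2 with odd-prime pr p≢2
... | m , 1≤m , refl = begin
  L (suc (m + m)) (m + m) / 1     ≡⟨ cong (_/ 1) (L-odd 1≤m) ⟩
  + (m * m) / 1                   ≡⟨ m*m/1≡[m+m]^2/4 m ⟩
  + ((m + m) ^ 2) / 4             ∎
  where open ≡-Reasoning
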